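{- Let $M=(E,I)$ be a matroid with independence oracle $\mathrm{Ind}$ and let $E'\subseteq E$. Consider the procedure DetectSingleCircuit$(E')$: if $\mathrm{Ind}(E')=1$, return $\perp$; otherwise let $S=\{e\in E':\mathrm{Ind}(E'\setminus\{e\})=1\}$; if $S=\emptyset$ return $\perp$, else return $S$. Then this procedure makes $|E'|+1$ queries to $\mathrm{Ind}$ in a single non-adaptive round, and returns $\perp$ if $E'$ contains no circuit or at least two distinct circuits, and otherwise (if $E'$ contains exactly one circuit) returns exactly the set of elements of the unique circuit contained in $E'$.
   Context: $\mathrm{Ind}(T)=1$ if $T\in I$ (independent) and $0$ otherwise. A circuit is a minimal dependent set. -}

module Defs where

open import Data.Nat using (ℕ; _<_)
open import Data.Bool using (Bool; true; false; if_then_else_)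
open import Data.Fin using (Fin)
open import Data.Fin.Subset using (Subset; ⊥; _∈_; _⊆_; _⊂_; _∪_; _-_; ⁅_⁆; ∣_∣; _∉_)
open import Data.Fin.Subset.Properties using (_∈?_)
open import Data.List using (List; []; _∷_; map; filter; foldr; zip)
open import Data.Bool.ListAction using (any)
open import Data.List.Base using (allFin)
open import Data.Maybe using (Maybe; just; nothing)
open import Data.Product using (_×_; _,_; ∃)
open import Relation.Binary.PropositionalEquality using (_≡_)
open import Relation.Nullary using (¬_)

Indep : {n : ℕ} → (Subset n → Bool) → Subset n → Set
Indep Ind T = Ind T ≡ true

record IsMatroid {n : ℕ} (Ind : Subset n → Bool) : Set where
  field
    empty-indep : Indep Ind ⊥
    hereditary  : ∀ {A B : Subset n} → A ⊆ B → Indep Ind B → Indep Ind A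
    exchange    : ∀ {A B : Subset n} → Indep Ind A → Indep Ind B → ∣ A ∣ < ∣ B ∣ →
                  ∃ λ x → x ∈ B × x ∉ A × Indep Ind (A ∪ ⁅ x ⁆)

IsCircuit : {n : ℕ} → (Subset n → Bool) → Subset n → Set
IsCircuit Ind C = ¬ Indep Ind C × (∀ D → D ⊂ C → Indep Ind D)

elems : {n : ℕ} → Subset n → List (Fin n)
elems {n} E' = filter (_∈? E') (allFin n)

queries : {n : ℕ} → Subset n → List (Subset n)
queries E' = E' ∷ map (E' -_) (elems E')

-- Post-processing of the oracle answers (it does not access the oracle).
-- nothing  plays the role of ⊥ (the "no answer" output).
decode : {n : ℕ} → Subset n → List Bool → Maybe (Subset n)
decode E' []            = nothing
decode E' (true  ∷ bs)  = nothing
decode E' (false ∷ bs)  =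
  if any (λ b → b) bs then just S else nothing
  where
  S = foldr (λ { (e , b) acc → if b then acc ∪ ⁅ e ⁆ else acc }) ⊥ (zip (elems E') bs)

detectSingleCircuit : {n : ℕ} → (Subset n → Bool) → Subset n → Maybe (Subset n)
detectSingleCircuit Ind E' = decode E' (map Ind (queries E'))

{-# OPTIONS --safe #-}
module Submission where

open import Defs
open import Data.Nat using (ℕ; suc)
open import Data.Bool using (Bool)
open import Data.List using (length)
open import Data.Maybe using (just; nothing)
open import Data.Fin.Subset using (Subset; _⊆_; ∣_∣)
open import Data.Product using (_×_; ∃)
open import Relation.Binary.PropositionalEquality using (_≡_; _≢_)
open import Relation.Nullary using (¬_)

open import Data.Bool using (true; false; _≟_)
open import Data.Bool.Properties using (¬-not; ∨-zeroʳ)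
open import Data.Bool.ListAction using (any)
open import Data.Empty using (⊥-elim)
open import Data.Fin using (Fin; suc)
open import Data.Fin.Properties using (any?) renaming (_≟_ to _≟ᶠ_)
open import Data.Fin.Subset using (⊥; _∈_; _∉_; _⊂_; _⊃_; _∪_; _─_; _-_; ⁅_⁆; Nonempty; inside; outside)
open import Data.Fin.Subset.Induction using (Acc; acc; ⊂-wellFounded; ⊃-wellFounded)
open import Data.Fin.Subset.Properties
open import Data.List using (List; []; _∷_; map; foldr; zip; filter; tabulate; allFin)
open import Data.List.Membership.Propositional using () renaming (_∈_ to _∈ˡ_)
open import Data.List.Membership.Propositional.Properties using (∈-map⁺; ∈-filter⁺; ∈-filter⁻; ∈-allFin)
open import Data.List.Properties using (length-map; map-tabulate; map-∘)
open import Data.List.Relation.Unary.All as All using (All; []; _∷_)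
open import Data.List.Relation.Unary.All.Properties using (all-filter) renaming (map⁺ to All-map⁺)
open import Data.List.Relation.Unary.Any using () renaming (here to hereˡ; there to thereˡ)
open import Data.Nat using (_≤_; _<?_)
open import Data.Nat.Properties using (≤-<-trans; n≮n; ≮⇒≥; suc-injective; ≤-trans; ≤-reflexive)
open import Data.Product using (_,_; proj₁; proj₂)
open import Data.Vec using ([]; _∷_; here; there)
open import Data.Sum using (inj₁; inj₂; [_,_]′)
open import Function using (id; _∘_; _⇔_; mk⇔; Equivalence)
open import Relation.Binary.PropositionalEquality using (refl; sym; trans; cong; cong₂; subst; module ≡-Reasoning)
open import Relation.Nullary using (yes; no; ¬?)
open import Relation.Unary using (Decidable)
open import Relation.Nullary.Decidable using (decidable-stable; _×-dec_)

-- Deleting e from E' leaves an independent set exactly when e lies on every circuit contained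
-- in E' (every dependent set contains a circuit), so the single round of queries marks the
-- intersection of those circuits. A unique circuit C is returned as it is, and C is nonempty
-- because ∅ is independent. For two distinct circuits C and D no deletion is independent: if
-- E' ∖ {e} were, take f ∈ C ∖ D and augment C ∖ {f} inside E' to an independent set of size
-- |E'| − 1; it cannot contain f, so it is E' ∖ {f}, which contains D.

private
  variable
    n : ℕ
    p q r : Subset n
    x y : Fin n

p⊆q∧x∉p⇒p⊆q-x : p ⊆ q → x ∉ p → p ⊆ q - x
p⊆q∧x∉p⇒p⊆q-x p⊆q x∉p {y} y∈p = x∈p∧x≢y⇒x∈p-y (p⊆q y∈p) λ { refl → x∉p y∈p }

p-x⊆q∧x∈q⇒p⊆q : p - x ⊆ q → x ∈ q → p ⊆ q
p-x⊆q∧x∈q⇒p⊆q {x = x} p-x⊆q x∈q {y} y∈p with y ≟ᶠ x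
... | yes refl = x∈q
... | no y≢x   = p-x⊆q (x∈p∧x≢y⇒x∈p-y y∈p y≢x)

p⊆r∧x∈r⇒p∪⁅x⁆⊆r : p ⊆ r → x ∈ r → p ∪ ⁅ x ⁆ ⊆ r
p⊆r∧x∈r⇒p∪⁅x⁆⊆r {r = r} p⊆r x∈r y∈ =
  [ p⊆r , (λ y∈⁅x⁆ → subst (_∈ r) (sym (x∈⁅y⁆⇒x≡y _ y∈⁅x⁆)) x∈r) ]′ (x∈p∪q⁻ _ _ y∈)

x∉p⇒p⊂p∪⁅x⁆ : x ∉ p → p ⊂ p ∪ ⁅ x ⁆
x∉p⇒p⊂p∪⁅x⁆ {x = x} x∉p = p⊆p∪q _ , x , x∈p∪q⁺ (inj₂ (x∈⁅x⁆ x)) , x∉p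

x∈p─q⇒x∉q : ∀ (p q : Subset n) → x ∈ p ─ q → x ∉ q
x∈p─q⇒x∉q (inside ∷ p) (outside ∷ q) here ()
x∈p─q⇒x∉q (_ ∷ p) (_ ∷ q) (there x∈p─q) (there x∈q) = x∈p─q⇒x∉q p q x∈p─q x∈q

x∉p-x : ∀ (p : Subset n) x → x ∉ p - x
x∉p-x p x x∈p-x = x∈p─q⇒x∉q p ⁅ x ⁆ x∈p-x (x∈⁅x⁆ x)

x∈p⇒∣p∣≡1+∣p-x∣ : x ∈ p → ∣ p ∣ ≡ suc ∣ p - x ∣
x∈p⇒∣p∣≡1+∣p-x∣ {p = inside  ∷ p} here        = cong (suc ∘ ∣_∣) (sym (p─⊥≡p p))
x∈p⇒∣p∣≡1+∣p-x∣ {p = inside  ∷ p} (there x∈p) = cong suc (x∈p⇒∣p∣≡1+∣p-x∣ x∈p)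
x∈p⇒∣p∣≡1+∣p-x∣ {p = outside ∷ p} (there x∈p) = x∈p⇒∣p∣≡1+∣p-x∣ x∈p

x,y∈p⇒∣p-x∣≡∣p-y∣ : x ∈ p → y ∈ p → ∣ p - x ∣ ≡ ∣ p - y ∣
x,y∈p⇒∣p-x∣≡∣p-y∣ x∈p y∈p = suc-injective (trans (sym (x∈p⇒∣p∣≡1+∣p-x∣ x∈p)) (x∈p⇒∣p∣≡1+∣p-x∣ y∈p))

p⊈q⇒∃∈p∖q : ¬ p ⊆ q → ∃ λ x → x ∈ p × x ∉ q
p⊈q⇒∃∈p∖q {p = p} {q} p⊈q =
  decidable-stable (any? λ x → x ∈? p ×-dec ¬? (x ∈? q)) λ ∄ →
    p⊈q λ {x} x∈p → decidable-stable (x ∈? q) λ x∉q → ∄ (x , x∈p , x∉q)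

p⊆q∧∣q∣≤∣p∣⇒q⊆p : p ⊆ q → ∣ q ∣ ≤ ∣ p ∣ → q ⊆ p
p⊆q∧∣q∣≤∣p∣⇒q⊆p {p = p} p⊆q ∣q∣≤∣p∣ {x} x∈q = decidable-stable (x ∈? p) λ x∉p →
  n≮n _ (≤-<-trans ∣q∣≤∣p∣
          (≤-<-trans (p⊆q⇒∣p∣≤∣q∣ (p⊆q∧x∉p⇒p⊆q-x p⊆q x∉p)) (x∈p⇒∣p-x∣<∣p∣ x∈q)))

∈-elems⁺ : x ∈ p → x ∈ˡ elems p
∈-elems⁺ {x = x} {p = p} = ∈-filter⁺ (_∈? p) (∈-allFin x)

∈-elems⁻ : x ∈ˡ elems p → x ∈ p
∈-elems⁻ {n} {p = p} = proj₂ ∘ ∈-filter⁻ (_∈? p) {xs = allFin n}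

filter-∈?-map-suc : ∀ s (p : Subset n) xs →
                    filter (_∈? s ∷ p) (map suc xs) ≡ map suc (filter (_∈? p) xs)
filter-∈?-map-suc s p []       = refl
filter-∈?-map-suc s p (x ∷ xs) with x ∈? p
... | yes _ = cong (suc x ∷_) (filter-∈?-map-suc s p xs)
... | no  _ = filter-∈?-map-suc s p xs

length-elems : ∀ (p : Subset n) → length (elems p) ≡ ∣ p ∣
length-elems-∷ : ∀ s (p : Subset n) → length (filter (_∈? s ∷ p) (tabulate suc)) ≡ ∣ p ∣

length-elems []            = refl
length-elems (inside  ∷ p) = cong suc (length-elems-∷ inside p)
length-elems (outside ∷ p) = length-elems-∷ outside p

length-elems-∷ {n} s p = begin
  length (filter (_∈? s ∷ p) (tabulate suc))        ≡⟨ cong (length ∘ filter (_∈? s ∷ p)) (map-tabulate id suc) ⟨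
  length (filter (_∈? s ∷ p) (map suc (allFin n)))  ≡⟨ cong length (filter-∈?-map-suc s p (allFin n)) ⟩
  length (map suc (elems p))                        ≡⟨ length-map suc (elems p) ⟩
  length (elems p)                                  ≡⟨ length-elems p ⟩
  ∣ p ∣                                             ∎
  where open ≡-Reasoning

length-queries : ∀ (E' : Subset n) → length (queries E') ≡ suc ∣ E' ∣
length-queries E' = cong suc (trans (length-map (E' -_) (elems E')) (length-elems E'))

any-true : ∀ {bs} → true ∈ˡ bs → any (λ b → b) bs ≡ true
any-true           (hereˡ refl) = refl
any-true {b ∷ bs} (thereˡ t∈bs) rewrite any-true t∈bs = ∨-zeroʳ b

any-false : ∀ {bs} → All (_≡ false) bs → any (λ b → b) bs ≡ false
any-false []          = refl
any-false (refl ∷ bs) = any-false bs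

module _ {A B : Set} (f : A → B) where

  ∈-zip-map⁺ : ∀ {xs a b} → a ∈ˡ xs → f a ≡ b → (a , b) ∈ˡ zip xs (map f xs)
  ∈-zip-map⁺ (hereˡ refl)  refl = hereˡ refl
  ∈-zip-map⁺ (thereˡ a∈xs) fa≡b = thereˡ (∈-zip-map⁺ a∈xs fa≡b)

  ∈-zip-map⁻ : ∀ xs {a b} → (a , b) ∈ˡ zip xs (map f xs) → a ∈ˡ xs × f a ≡ b
  ∈-zip-map⁻ (_ ∷ xs) (hereˡ refl) = hereˡ refl , refl
  ∈-zip-map⁻ (_ ∷ xs) (thereˡ ab∈) = let (a∈xs , fa≡b) = ∈-zip-map⁻ xs ab∈ in thereˡ a∈xs , fa≡b

-- decode collects the marked elements with a pattern-matching lambda, which cannot be named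
-- here, so these lemmas are stated for any step function with the same defining equations.
module Marking (step : Fin n × Bool → Subset n → Subset n)
               (step-true  : ∀ e acc → step (e , true)  acc ≡ acc ∪ ⁅ e ⁆)
               (step-false : ∀ e acc → step (e , false) acc ≡ acc) where

  ∈-marked⁺ : ∀ {ps} → (x , true) ∈ˡ ps → x ∈ foldr step ⊥ ps
  ∈-marked⁺ {x = x} {(e , true) ∷ ps} (hereˡ refl) =
    subst (x ∈_) (sym (step-true e _)) (x∈p∪q⁺ (inj₂ (x∈⁅x⁆ x)))
  ∈-marked⁺ {x = x} {(e , true) ∷ ps} (thereˡ m) =
    subst (x ∈_) (sym (step-true e _)) (x∈p∪q⁺ (inj₁ (∈-marked⁺ m)))
  ∈-marked⁺ {x = x} {(e , false) ∷ ps} (thereˡ m) =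
    subst (x ∈_) (sym (step-false e _)) (∈-marked⁺ m)

  ∈-marked⁻ : ∀ ps → x ∈ foldr step ⊥ ps → (x , true) ∈ˡ ps
  ∈-marked⁻ []                 x∈ = ⊥-elim (∉⊥ x∈)
  ∈-marked⁻ {x = x} ((e , true) ∷ ps) x∈ with x∈p∪q⁻ _ _ (subst (x ∈_) (step-true e _) x∈)
  ... | inj₁ x∈rest = thereˡ (∈-marked⁻ ps x∈rest)
  ... | inj₂ x∈⁅e⁆  = hereˡ (cong (_, true) (x∈⁅y⁆⇒x≡y e x∈⁅e⁆))
  ∈-marked⁻ {x = x} ((e , false) ∷ ps) x∈ =
    thereˡ (∈-marked⁻ ps (subst (x ∈_) (step-false e _) x∈))

decode-none : ∀ (E' : Subset n) {bs} → All (_≡ false) bs → decode E' (false ∷ bs) ≡ nothing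
decode-none E' none rewrite any-false none = refl

decode-marked : ∀ (E' : Subset n) {bs S} → true ∈ˡ bs →
                (∀ e → (e , true) ∈ˡ zip (elems E') bs ⇔ e ∈ S) → decode E' (false ∷ bs) ≡ just S
decode-marked E' t∈bs marked⇔∈S rewrite any-true t∈bs = cong just (⊆-antisym
  (λ e∈marked → Equivalence.to (marked⇔∈S _)
                  (Marking.∈-marked⁻ _ (λ _ _ → refl) (λ _ _ → refl) _ e∈marked))
  (λ e∈S → Marking.∈-marked⁺ _ (λ _ _ → refl) (λ _ _ → refl) (Equivalence.from (marked⇔∈S _) e∈S)))

module _ (Ind : Subset n → Bool) (E' : Subset n) where

  private
    answers : List Bool
    answers = map Ind (map (E' -_) (elems E'))

  detect-indep : Indep Ind E' → detectSingleCircuit Ind E' ≡ nothing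
  detect-indep indepE' rewrite indepE' = refl

  detect-removals-dependent : (∀ e → e ∈ E' → ¬ Indep Ind (E' - e)) →
                              detectSingleCircuit Ind E' ≡ nothing
  detect-removals-dependent dep with Ind E'
  ... | true  = refl
  ... | false = decode-none E' {answers}
                  (All-map⁺ (All-map⁺ (All.map (¬-not ∘ dep _) (all-filter (_∈? E') (allFin _)))))

  detect-dependent : ∀ {S} → ¬ Indep Ind E' → (∀ e → e ∈ E' → Indep Ind (E' - e) ⇔ e ∈ S) →
                     S ⊆ E' → Nonempty S → detectSingleCircuit Ind E' ≡ just S
  detect-dependent {S} dep removable⇔∈S S⊆E' (x , x∈S) = begin
    decode E' (Ind E' ∷ answers)
      ≡⟨ cong₂ (λ b bs → decode E' (b ∷ bs)) (¬-not dep) (sym (map-∘ (elems E'))) ⟩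
    decode E' (false ∷ map answer (elems E'))
      ≡⟨ decode-marked E' some-removable marked⇔∈S ⟩
    just S
      ∎
    where
    open ≡-Reasoning

    answer : Fin n → Bool
    answer e = Ind (E' - e)

    S⇒removable : ∀ {e} → e ∈ S → answer e ≡ true
    S⇒removable {e} e∈S = Equivalence.from (removable⇔∈S e (S⊆E' e∈S)) e∈S

    some-removable : true ∈ˡ map answer (elems E')
    some-removable = subst (_∈ˡ map answer (elems E')) (S⇒removable x∈S)
                           (∈-map⁺ answer (∈-elems⁺ (S⊆E' x∈S)))

    marked⇔∈S : ∀ e → (e , true) ∈ˡ zip (elems E') (map answer (elems E')) ⇔ e ∈ S
    marked⇔∈S e = mk⇔
      (λ marked → let (e∈elems , removable) = ∈-zip-map⁻ answer (elems E') marked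
                  in Equivalence.to (removable⇔∈S e (∈-elems⁻ e∈elems)) removable)
      (λ e∈S → ∈-zip-map⁺ answer (∈-elems⁺ (S⊆E' e∈S)) (S⇒removable e∈S))

indep? : (Ind : Subset n → Bool) → Decidable (Indep Ind)
indep? Ind T = Ind T ≟ true

module _ {Ind : Subset n → Bool} (M : IsMatroid Ind) where

  open IsMatroid M

  dependent⇒nonempty : ¬ Indep Ind p → Nonempty p
  dependent⇒nonempty {p} dep = decidable-stable (nonempty? p) λ empty →
    dep (subst (Indep Ind) (sym (Empty-unique empty)) empty-indep)

  indep-removal⇒∈dependent : Indep Ind (q - x) → p ⊆ q → ¬ Indep Ind p → x ∈ p
  indep-removal⇒∈dependent {x = x} {p = p} indep p⊆q dep = decidable-stable (x ∈? p) λ x∉p →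
    dep (hereditary (p⊆q∧x∉p⇒p⊆q-x p⊆q x∉p) indep)

  dependent⊆circuit⇒≡ : ¬ Indep Ind p → IsCircuit Ind q → p ⊆ q → p ≡ q
  dependent⊆circuit⇒≡ {p} depP (_ , minQ) p⊆q = ⊆-antisym p⊆q λ {x} x∈q →
    decidable-stable (x ∈? p) λ x∉p → depP (minQ p (p⊆q , x , x∈q , x∉p))

  removals-indep⇒circuit : ¬ Indep Ind p → (∀ x → x ∈ p → Indep Ind (p - x)) → IsCircuit Ind p
  removals-indep⇒circuit dep removals-indep =
    dep , λ q (q⊆p , x , x∈p , x∉q) → hereditary (p⊆q∧x∉p⇒p⊆q-x q⊆p x∉q) (removals-indep x x∈p)

  dependent⇒∃circuit : ¬ Indep Ind p → ∃ λ C → C ⊆ p × IsCircuit Ind C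
  dependent⇒∃circuit = go (⊂-wellFounded _)
    where
    go : Acc _⊂_ p → ¬ Indep Ind p → ∃ λ C → C ⊆ p × IsCircuit Ind C
    go {p} (acc smaller) dep with any? (λ x → x ∈? p ×-dec ¬? (indep? Ind (p - x)))
    ... | yes (x , x∈p , dep-x) =
      let (C , C⊆p-x , circuit) = go (smaller (x∈p⇒p-x⊂p x∈p)) dep-x
      in C , ⊆-trans C⊆p-x (p─q⊆p _ _) , circuit
    ... | no ∄ = p , ⊆-refl , removals-indep⇒circuit dep λ x x∈p →
      decidable-stable (indep? Ind (p - x)) λ dep-x → ∄ (x , x∈p , dep-x)

  circuit-free⇒indep : (¬ ∃ λ C → C ⊆ p × IsCircuit Ind C) → Indep Ind p
  circuit-free⇒indep {p} circuit-free =
    decidable-stable (indep? Ind p) (circuit-free ∘ dependent⇒∃circuit)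

  augment : ∀ {X A B} → A ⊆ X → B ⊆ X → Indep Ind A → Indep Ind B →
            ∃ λ A' → A ⊆ A' × A' ⊆ X × Indep Ind A' × ∣ B ∣ ≤ ∣ A' ∣
  augment {X} {A} {B} A⊆X B⊆X indepA indepB = go (⊃-wellFounded A) A⊆X indepA
    where
    go : ∀ {A} → Acc _⊃_ A → A ⊆ X → Indep Ind A →
         ∃ λ A' → A ⊆ A' × A' ⊆ X × Indep Ind A' × ∣ B ∣ ≤ ∣ A' ∣
    go {A} (acc larger) A⊆X indepA with ∣ A ∣ <? ∣ B ∣
    ... | no ∣A∣≮∣B∣ = A , ⊆-refl , A⊆X , indepA , ≮⇒≥ ∣A∣≮∣B∣
    ... | yes ∣A∣<∣B∣ =
      let (x , x∈B , x∉A , indepA+x) = exchange indepA indepB ∣A∣<∣B∣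
          (A' , A+x⊆A' , rest) =
            go (larger (x∉p⇒p⊂p∪⁅x⁆ x∉A)) (p⊆r∧x∈r⇒p∪⁅x⁆⊆r A⊆X (B⊆X x∈B)) indepA+x
      in A' , ⊆-trans (p⊆p∪q _) A+x⊆A' , rest

  -- Augment q - y inside p to the size of p - x: the result avoids y (or it would contain q),
  -- so it is all of p - y.
  indep-removal-transfer : Indep Ind (p - x) → q ⊆ p → IsCircuit Ind q → y ∈ q → Indep Ind (p - y)
  indep-removal-transfer {p} {x} {q} {y} indep-p-x q⊆p (depQ , minQ) y∈q
    with augment (⊆-trans (p─q⊆p _ _) q⊆p) (p─q⊆p _ _) (minQ (q - y) (x∈p⇒p-x⊂p y∈q)) indep-p-x
  ... | A , q-y⊆A , A⊆p , indepA , ∣p-x∣≤∣A∣ = hereditary (p⊆q∧∣q∣≤∣p∣⇒q⊆p A⊆p-y ∣p-y∣≤∣A∣) indepA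
    where
    A⊆p-y : A ⊆ p - y
    A⊆p-y = p⊆q∧x∉p⇒p⊆q-x A⊆p λ y∈A → depQ (hereditary (p-x⊆q∧x∈q⇒p⊆q q-y⊆A y∈A) indepA)

    x∈p : x ∈ p
    x∈p = q⊆p (indep-removal⇒∈dependent indep-p-x q⊆p depQ)

    ∣p-y∣≤∣A∣ : ∣ p - y ∣ ≤ ∣ A ∣
    ∣p-y∣≤∣A∣ = ≤-trans (≤-reflexive (x,y∈p⇒∣p-x∣≡∣p-y∣ (q⊆p y∈q) x∈p)) ∣p-x∣≤∣A∣

  distinct-circuits⇒removals-dependent : ∀ {C D} → C ⊆ p → IsCircuit Ind C → D ⊆ p → IsCircuit Ind D →
                                         C ≢ D → ∀ x → ¬ Indep Ind (p - x)
  distinct-circuits⇒removals-dependent C⊆p circuitC D⊆p circuitD C≢D x indep-p-x =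
    let (y , y∈C , y∉D) = p⊈q⇒∃∈p∖q (C≢D ∘ dependent⊆circuit⇒≡ (proj₁ circuitC) circuitD)
        indep-p-y       = indep-removal-transfer indep-p-x C⊆p circuitC y∈C
    in y∉D (indep-removal⇒∈dependent indep-p-y D⊆p (proj₁ circuitD))

  unique-circuit⇒indep-removal⇔∈ : ∀ {C} → C ⊆ p → IsCircuit Ind C →
                                   (∀ D → D ⊆ p → IsCircuit Ind D → D ≡ C) →
                                   ∀ x → Indep Ind (p - x) ⇔ x ∈ C
  unique-circuit⇒indep-removal⇔∈ {p} {C} C⊆p (depC , _) unique x = mk⇔
    (λ indep-p-x → indep-removal⇒∈dependent indep-p-x C⊆p depC)
    (λ x∈C → decidable-stable (indep? Ind (p - x)) λ dep-p-x →
       let (D , D⊆p-x , circuitD) = dependent⇒∃circuit dep-p-x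
           D≡C = unique D (⊆-trans D⊆p-x (p─q⊆p _ _)) circuitD
       in x∉p-x p x (D⊆p-x (subst (x ∈_) (sym D≡C) x∈C)))

mainTheorem14 : {n : ℕ} (Ind : Subset n → Bool) → IsMatroid Ind → (E' : Subset n) →
    (length (queries E') ≡ suc ∣ E' ∣)
    × ((¬ ∃ λ C → C ⊆ E' × IsCircuit Ind C) → detectSingleCircuit Ind E' ≡ nothing)
    × ((∃ λ C → ∃ λ D → C ⊆ E' × IsCircuit Ind C × D ⊆ E' × IsCircuit Ind D × C ≢ D)
        → detectSingleCircuit Ind E' ≡ nothing)
    × (∀ C → C ⊆ E' → IsCircuit Ind C → (∀ D → D ⊆ E' → IsCircuit Ind D → D ≡ C)
        → detectSingleCircuit Ind E' ≡ just C)
mainTheorem14 Ind M E' =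
    length-queries E'
  , detect-indep Ind E' ∘ circuit-free⇒indep M
  , (λ (C , D , C⊆E' , circuitC , D⊆E' , circuitD , C≢D) → detect-removals-dependent Ind E' λ x _ →
       distinct-circuits⇒removals-dependent M C⊆E' circuitC D⊆E' circuitD C≢D x)
  , λ C C⊆E' circuitC unique → detect-dependent Ind E'
       (λ indepE' → proj₁ circuitC (IsMatroid.hereditary M C⊆E' indepE'))
       (λ x _ → unique-circuit⇒indep-removal⇔∈ M C⊆E' circuitC unique x)
       C⊆E' (dependent⇒nonempty M (proj₁ circuitC))
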